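{- Let $p$ be an odd prime, let $H$ be a graph with vertex set $[m]$ and edge set $E$, and let $\lambda_1,\dots,\lambda_m$ be distinct elements of $\mathbb{F}_p$; write $\lambda_{ij} = \lambda_j - \lambda_i$. Let $G_p(H)$ be the graph with vertex set $\bigcup_{i=1}^m X_i$, $X_i = \mathbb{F}_p^2 \times \{i\}$, in which, for each $\{i,j\} \in E$, $(x,i)$ is adjacent to $(y,j)$ if and only if $y = x + \lambda_{ij}(a,a^2)$ for some $a \in \mathbb{F}_p^*$, and there are no other edges. For $v \in \mathbb{F}_p^2$ and $a \in \mathbb{F}_p^*$, let $H(v,a)$ be the subgraph of $G_p(H)$ induced by $\{(v + \lambda_i(a,a^2), i) : i \in [m]\}$. If $C = (x,i)(y,j)(z,k)(w,l)$ is a cycle of length four in $G_p(H)$ with $\chi(\lambda_{ij}\lambda_{jk}\lambda_{kl}\lambda_{li}) = -1$, then $C \subseteq H(v,a)$ for some $v \in \mathbb{F}_p^2$ and $a \in \mathbb{F}_p^*$.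
   Context: $\chi$ denotes the quadratic character of $\mathbb{F}_p$: $\chi(x)=1$ if $x$ is a nonzero square, $\chi(x)=-1$ if $x$ is a nonsquare, $\chi(0)=0$. Scalar multiplication $\lambda(a,a^2)$ is componentwise in $\mathbb{F}_p^2$. -}

module Defs where

open import Data.Nat using (ℕ)
open import Data.Integer using (ℤ; +_; _-_; _+_; _*_)
open import Data.Integer.Divisibility using (_∣_)
open import Data.Fin using (Fin)
open import Data.Product using (_×_; _,_; ∃; proj₁; proj₂)
open import Relation.Nullary using (¬_)
open import Relation.Binary.PropositionalEquality using (_≡_; _≢_)

-- Elements of F_p are represented by integers; equality in F_p is congruence mod p.
_≈[_]_ : ℤ → ℕ → ℤ → Set
x ≈[ p ] y = (+ p) ∣ (x - y)

NonzeroMod : ℕ → ℤ → Set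
NonzeroMod p a = ¬ (a ≈[ p ] (+ 0))

IsSquareMod : ℕ → ℤ → Set
IsSquareMod p x = ∃ λ y → (y * y) ≈[ p ] x

-- χ(x) = -1 : x is a nonsquare in F_p (0 = 0² is a square)
χ≡-1 : ℕ → ℤ → Set
χ≡-1 p x = ¬ IsSquareMod p x

Pt : Set
Pt = ℤ × ℤ

_≈ᵖ[_]_ : Pt → ℕ → Pt → Set
(x₁ , x₂) ≈ᵖ[ p ] (y₁ , y₂) = (x₁ ≈[ p ] y₁) × (x₂ ≈[ p ] y₂)

shift : Pt → ℤ → ℤ → Pt
shift (v₁ , v₂) c a = (v₁ + c * a , v₂ + c * (a * a))

record Graph (m : ℕ) : Set₁ where
  field
    E      : Fin m → Fin m → Set
    sym    : ∀ {i j} → E i j → E j i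
    irrefl : ∀ {i} → ¬ E i i
open Graph public

Vtx : ℕ → Set
Vtx m = Pt × Fin m

lamDiff : ∀ {m} → (Fin m → ℤ) → Fin m → Fin m → ℤ
lamDiff Λ i j = Λ j - Λ i

VEq : ℕ → ∀ {m} → Vtx m → Vtx m → Set
VEq p (x , i) (y , j) = (i ≡ j) × (x ≈ᵖ[ p ] y)

Adj : ℕ → ∀ {m} → Graph m → (Fin m → ℤ) → Vtx m → Vtx m → Set
Adj p H Λ (x , i) (y , j) =
  E H i j × ∃ λ a → NonzeroMod p a × (y ≈ᵖ[ p ] shift x (lamDiff Λ i j) a)

Cycle4 : ℕ → ∀ {m} → Graph m → (Fin m → ℤ) → Vtx m → Vtx m → Vtx m → Vtx m → Set
Cycle4 p H Λ u₁ u₂ u₃ u₄ =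
  (Adj p H Λ u₁ u₂ × Adj p H Λ u₂ u₃ × Adj p H Λ u₃ u₄ × Adj p H Λ u₄ u₁)
  × (¬ VEq p u₁ u₂ × ¬ VEq p u₁ u₃ × ¬ VEq p u₁ u₄
     × ¬ VEq p u₂ u₃ × ¬ VEq p u₂ u₄ × ¬ VEq p u₃ u₄)

InHva : ℕ → ∀ {m} → (Fin m → ℤ) → Pt → ℤ → Vtx m → Set
InHva p Λ v a (x , i) = x ≈ᵖ[ p ] shift v (Λ i) a

module Submission where

open import Defs
open import Data.Nat using (ℕ)
open import Data.Nat.Primality using (Prime)
open import Data.Integer using (ℤ; _*_)
open import Data.Fin using (Fin)
open import Data.Product using (_×_; _,_; ∃)
open import Relation.Nullary using (¬_)
open import Relation.Binary.PropositionalEquality using (_≢_)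

open import Level using (0ℓ)
import Data.Nat as ℕ
import Data.Nat.Divisibility as ℕ
open import Data.Nat.Primality using (euclidsLemma; prime⇒irreducible)
open import Data.Nat.Coprimality using (Coprime; coprime-Bézout)
open import Data.Nat.GCD using (module Bézout)
open import Data.Integer using (+_; -[1+_]; _+_; _-_; -_; ∣_∣)
open import Data.Integer.Properties using (+-identityʳ; abs-*; pos-*; pos-+)
open import Data.Integer.Divisibility.Signed as Signed
  using (∣ᵤ⇒∣; ∣⇒∣ᵤ; ∣m∣n⇒∣m+n; ∣m⇒∣-m; ∣n⇒∣m*n)
open import Data.Integer.Tactic.RingSolver using (solve-∀; solve)
open import Data.List using (_∷_; [])
open import Data.Product using (proj₁; proj₂; uncurry)
import Data.Product as Product
open import Data.Sum using (_⊎_; inj₁; inj₂; reduce)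
import Data.Sum as Sum
open import Function using (_∘_; case_of_)
open import Relation.Nullary using (Dec; yes; no; map′; contradiction)
open import Relation.Binary.Bundles using (Setoid)
open import Relation.Binary.Core using (_⇒_)
open import Relation.Binary.Definitions using (Reflexive; Symmetric; Transitive)
open import Relation.Binary.PropositionalEquality
  using (_≡_; refl; subst; cong; module ≡-Reasoning)
import Relation.Binary.PropositionalEquality as ≡
import Relation.Binary.Reasoning.Setoid as SetoidReasoning

-- Write the cycle as y = x + λ_ij (a,a²), z = y + λ_jk (b,b²), w = z + λ_kl (c,c²),
-- x = w + λ_li (d,d²). Going around the cycle, Σ λ t = 0 and Σ λ t² = 0 over the four
-- steps. As the λ's around a cycle sum to zero, these relations survive the substitution
-- t ↦ t − a, after which the first step drops out; eliminating d − a leaves a zero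
-- (b − a, c − a) of a binary quadratic form whose discriminant is λ_ij λ_jk λ_kl λ_li.
-- A form with nonsquare discriminant is anisotropic, so b = c = a, and then all four
-- vertices lie in H(v,a) for v = x − λ_i (a,a²).

quadForm : ℤ → ℤ → ℤ → ℤ → ℤ → ℤ
quadForm A B C u s = A * (u * u) + + 2 * B * (u * s) + C * (s * s)

recentre-linear : ∀ ℓᵢ ℓⱼ ℓₖ ℓₗ a b c d →
  (ℓₖ - ℓⱼ) * (b - a) + (ℓₗ - ℓₖ) * (c - a) + (ℓᵢ - ℓₗ) * (d - a)
  ≡ (ℓⱼ - ℓᵢ) * a + (ℓₖ - ℓⱼ) * b + (ℓₗ - ℓₖ) * c + (ℓᵢ - ℓₗ) * d
recentre-linear = solve-∀

recentre-quadratic : ∀ ℓᵢ ℓⱼ ℓₖ ℓₗ a b c d →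
  (ℓₖ - ℓⱼ) * ((b - a) * (b - a)) + (ℓₗ - ℓₖ) * ((c - a) * (c - a))
    + (ℓᵢ - ℓₗ) * ((d - a) * (d - a))
  ≡ ((ℓⱼ - ℓᵢ) * (a * a) + (ℓₖ - ℓⱼ) * (b * b) + (ℓₗ - ℓₖ) * (c * c) + (ℓᵢ - ℓₗ) * (d * d))
    - + 2 * a * ((ℓⱼ - ℓᵢ) * a + (ℓₖ - ℓⱼ) * b + (ℓₗ - ℓₖ) * c + (ℓᵢ - ℓₗ) * d)
recentre-quadratic = solve-∀

cycle-product≡discriminant : ∀ ℓᵢ ℓⱼ ℓₖ ℓₗ →
  (ℓⱼ - ℓᵢ) * (ℓₖ - ℓⱼ) * (ℓₗ - ℓₖ) * (ℓᵢ - ℓₗ)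
  ≡ ((ℓₖ - ℓⱼ) * (ℓₗ - ℓₖ)) * ((ℓₖ - ℓⱼ) * (ℓₗ - ℓₖ))
    - ((ℓₖ - ℓⱼ) * ((ℓₖ - ℓⱼ) + (ℓᵢ - ℓₗ))) * ((ℓₗ - ℓₖ) * ((ℓₗ - ℓₖ) + (ℓᵢ - ℓₗ)))
cycle-product≡discriminant = solve-∀

pos-1+ab≡cd : ∀ a b c d → 1 ℕ.+ a ℕ.* b ≡ c ℕ.* d → + 1 + + a * + b ≡ + c * + d
pos-1+ab≡cd a b c d eq = begin
  + 1 + + a * + b      ≡⟨ cong (_+_ (+ 1)) (pos-* a b) ⟨
  + 1 + + (a ℕ.* b)    ≡⟨ pos-+ 1 (a ℕ.* b) ⟨
  + (1 ℕ.+ a ℕ.* b)    ≡⟨ cong +_ eq ⟩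
  + (c ℕ.* d)          ≡⟨ pos-* c d ⟩
  + c * + d            ∎
  where open ≡-Reasoning

module Congruence (p : ℕ) where

  -- A record rather than a synonym for _≈[ p ]_, so that unification can read x and y
  -- off x ≈ y (the unfolded divisibility ∣ x - y ∣ would hide them).
  infix 4 _≈_
  record _≈_ (x y : ℤ) : Set where
    constructor wrap
    field unwrap : x ≈[ p ] y
  open _≈_ public

  private
    ∣⇒≈ : ∀ {x y e} → + p Signed.∣ e → e ≡ x - y → x ≈ y
    ∣⇒≈ p∣e refl = wrap (∣⇒∣ᵤ p∣e)

    ≈⇒∣ : ∀ {x y} → x ≈ y → + p Signed.∣ (x - y)
    ≈⇒∣ (wrap x≈y) = ∣ᵤ⇒∣ x≈y

  ≈-reflexive : _≡_ ⇒ _≈_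
  ≈-reflexive {x} refl = ∣⇒≈ (Signed.divides (+ 0) refl) (solve (x ∷ []))

  ≈-refl : Reflexive _≈_
  ≈-refl {x} = ≈-reflexive {x} refl

  ≈-sym : Symmetric _≈_
  ≈-sym {x} {y} x≈y = ∣⇒≈ (∣m⇒∣-m (≈⇒∣ x≈y)) (solve (x ∷ y ∷ []))

  ≈-trans : Transitive _≈_
  ≈-trans {x} {y} {z} x≈y y≈z =
    ∣⇒≈ (∣m∣n⇒∣m+n (≈⇒∣ x≈y) (≈⇒∣ y≈z)) (solve (x ∷ y ∷ z ∷ []))

  ≈-setoid : Setoid 0ℓ 0ℓ
  ≈-setoid = record
    { Carrier       = ℤ
    ; _≈_           = _≈_
    ; isEquivalence = record { refl = ≈-refl ; sym = ≈-sym ; trans = ≈-trans }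
    }

  module ≈-Reasoning = SetoidReasoning ≈-setoid

  +-cong : ∀ {x y u v} → x ≈ y → u ≈ v → x + u ≈ y + v
  +-cong {x} {y} {u} {v} x≈y u≈v =
    ∣⇒≈ (∣m∣n⇒∣m+n (≈⇒∣ x≈y) (≈⇒∣ u≈v)) (solve (x ∷ y ∷ u ∷ v ∷ []))

  *-cong : ∀ {x y u v} → x ≈ y → u ≈ v → x * u ≈ y * v
  *-cong {x} {y} {u} {v} x≈y u≈v =
    ∣⇒≈ (∣m∣n⇒∣m+n (∣n⇒∣m*n u (≈⇒∣ x≈y)) (∣n⇒∣m*n y (≈⇒∣ u≈v)))
        (solve (x ∷ y ∷ u ∷ v ∷ []))

  -‿cong : ∀ {x y} → x ≈ y → - x ≈ - y
  -‿cong {x} {y} x≈y = ∣⇒≈ (∣m⇒∣-m (≈⇒∣ x≈y)) (solve (x ∷ y ∷ []))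

  +-congˡ : ∀ x {u v} → u ≈ v → x + u ≈ x + v
  +-congˡ x = +-cong (≈-refl {x})

  +-congʳ : ∀ x {u v} → u ≈ v → u + x ≈ v + x
  +-congʳ x u≈v = +-cong u≈v (≈-refl {x})

  *-congˡ : ∀ x {u v} → u ≈ v → x * u ≈ x * v
  *-congˡ x = *-cong (≈-refl {x})

  *-congʳ : ∀ x {u v} → u ≈ v → u * x ≈ v * x
  *-congʳ x u≈v = *-cong u≈v (≈-refl {x})

  x-y≈0⇒x≈y : ∀ x y → x - y ≈ + 0 → x ≈ y
  x-y≈0⇒x≈y x y x-y≈0 = begin
    x             ≡⟨ solve (x ∷ y ∷ []) ⟩
    (x - y) + y   ≈⟨ +-congʳ y x-y≈0 ⟩
    + 0 + y       ≡⟨ solve (y ∷ []) ⟩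
    y             ∎
    where open ≈-Reasoning

  x≈x+e⇒e≈0 : ∀ {x e} → x ≈ x + e → e ≈ + 0
  x≈x+e⇒e≈0 {x} {e} x≈x+e = begin
    e               ≡⟨ solve (x ∷ e ∷ []) ⟩
    (x + e) - x     ≈⟨ +-congʳ (- x) (≈-sym x≈x+e) ⟩
    x - x           ≡⟨ solve (x ∷ []) ⟩
    + 0             ∎
    where open ≈-Reasoning

  step-trans : ∀ x {y z e f} → y ≈ x + e → z ≈ y + f → z ≈ x + (e + f)
  step-trans x {y} {z} {e} {f} y≈x+e z≈y+f = begin
    z               ≈⟨ z≈y+f ⟩
    y + f           ≈⟨ +-congʳ f y≈x+e ⟩
    (x + e) + f     ≡⟨ solve (x ∷ e ∷ f ∷ []) ⟩
    x + (e + f)     ∎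
    where open ≈-Reasoning

  closed-walk-sum≈0 : ∀ {x y z w e₁ e₂ e₃ e₄} →
    y ≈ x + e₁ → z ≈ y + e₂ → w ≈ z + e₃ → x ≈ w + e₄ → e₁ + e₂ + e₃ + e₄ ≈ + 0
  closed-walk-sum≈0 {x} x→y y→z z→w w→x =
    x≈x+e⇒e≈0 {x} (step-trans x (step-trans x (step-trans x x→y y→z) z→w) w→x)

  closed-walk⇒power-sums≈0 : ∀ (x y z w : Pt) α β γ δ a b c d →
    y ≈ᵖ[ p ] shift x α a → z ≈ᵖ[ p ] shift y β b →
    w ≈ᵖ[ p ] shift z γ c → x ≈ᵖ[ p ] shift w δ d →
    α * a + β * b + γ * c + δ * d ≈ + 0
    × α * (a * a) + β * (b * b) + γ * (c * c) + δ * (d * d) ≈ + 0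
  closed-walk⇒power-sums≈0 (x₁ , x₂) (y₁ , y₂) (z₁ , z₂) (w₁ , w₂) α β γ δ a b c d
    (y₁≈ , y₂≈) (z₁≈ , z₂≈) (w₁≈ , w₂≈) (x₁≈ , x₂≈) =
      closed-walk-sum≈0 {x₁} {y₁} {z₁} {w₁} (wrap y₁≈) (wrap z₁≈) (wrap w₁≈) (wrap x₁≈)
    , closed-walk-sum≈0 {x₂} {y₂} {z₂} {w₂} (wrap y₂≈) (wrap z₂≈) (wrap w₂≈) (wrap x₂≈)

  shift-back : ∀ (x : Pt) ℓ a → x ≈ᵖ[ p ] shift (shift x (- ℓ) a) ℓ a
  shift-back (x₁ , x₂) ℓ a = unwrap (cancel x₁ a) , unwrap (cancel x₂ (a * a))
    where
    cancel : ∀ x e → x ≈ x + - ℓ * e + ℓ * e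
    cancel x e = ≈-reflexive (solve (x ∷ ℓ ∷ e ∷ []))

  along-edge : ∀ {v x y e f} ℓ ℓ′ →
    x ≈ v + ℓ * e → y ≈ x + (ℓ′ - ℓ) * f → f ≈ e → y ≈ v + ℓ′ * e
  along-edge {v} {x} {y} {e} {f} ℓ ℓ′ x≈ y≈ f≈e = begin
    y                            ≈⟨ y≈ ⟩
    x + (ℓ′ - ℓ) * f             ≈⟨ +-cong x≈ (*-congˡ (ℓ′ - ℓ) f≈e) ⟩
    (v + ℓ * e) + (ℓ′ - ℓ) * e   ≡⟨ solve (v ∷ ℓ ∷ ℓ′ ∷ e ∷ []) ⟩
    v + ℓ′ * e                   ∎
    where open ≈-Reasoning

  shift-along : ∀ (v x y : Pt) ℓ ℓ′ {a b} →
    x ≈ᵖ[ p ] shift v ℓ a → y ≈ᵖ[ p ] shift x (ℓ′ - ℓ) b → b ≈ a →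
    y ≈ᵖ[ p ] shift v ℓ′ a
  shift-along (v₁ , v₂) (x₁ , x₂) (y₁ , y₂) ℓ ℓ′ (x₁≈ , x₂≈) (y₁≈ , y₂≈) b≈a =
      unwrap (along-edge {v₁} {x₁} {y₁} ℓ ℓ′ (wrap x₁≈) (wrap y₁≈) b≈a)
    , unwrap (along-edge {v₂} {x₂} {y₂} ℓ ℓ′ (wrap x₂≈) (wrap y₂≈) (*-cong b≈a b≈a))

  eliminate-last-variable : ∀ β γ δ u s t →
    β * u + γ * s + δ * t ≈ + 0 → β * (u * u) + γ * (s * s) + δ * (t * t) ≈ + 0 →
    quadForm (β * (β + δ)) (β * γ) (γ * (γ + δ)) u s ≈ + 0
  eliminate-last-variable β γ δ u s t linear quadratic = begin
    β * (β + δ) * (u * u) + + 2 * (β * γ) * (u * s) + γ * (γ + δ) * (s * s)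
      ≡⟨ solve (β ∷ γ ∷ δ ∷ u ∷ s ∷ t ∷ []) ⟩
    δ * (β * (u * u) + γ * (s * s) + δ * (t * t))
      - (δ * t - β * u - γ * s) * (β * u + γ * s + δ * t)
      ≈⟨ +-cong (*-congˡ δ quadratic) (-‿cong (*-congˡ (δ * t - β * u - γ * s) linear)) ⟩
    δ * + 0 - (δ * t - β * u - γ * s) * + 0
      ≡⟨ solve (β ∷ γ ∷ δ ∷ u ∷ s ∷ t ∷ []) ⟩
    + 0 ∎
    where open ≈-Reasoning

  ≈0? : ∀ x → Dec (x ≈ + 0)
  ≈0? x = map′ wrap unwrap (p ℕ.∣? ∣ x - + 0 ∣)

  ≈0⇒∣ : ∀ {x} → x ≈ + 0 → p ℕ.∣ ∣ x ∣
  ≈0⇒∣ {x} (wrap p∣x) = subst (p ℕ.∣_) (cong ∣_∣ (+-identityʳ x)) p∣x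

  ∣⇒≈0 : ∀ {x} → p ℕ.∣ ∣ x ∣ → x ≈ + 0
  ∣⇒≈0 {x} p∣x = wrap (subst (p ℕ.∣_) (cong ∣_∣ (≡.sym (+-identityʳ x))) p∣x)

  square : ∀ r {x} → r * r ≈ x → IsSquareMod p x
  square r (wrap r²≈x) = r , r²≈x

  1+xp≡yn⇒ny≈1 : ∀ x y n → + 1 + x * + p ≡ y * n → n * y ≈ + 1
  1+xp≡yn⇒ny≈1 x y n eq = ∣⇒≈ (Signed.divides x refl) (rearrange x y n (+ p) eq)
    where
    rearrange : ∀ x y n P → + 1 + x * P ≡ y * n → x * P ≡ n * y - + 1
    rearrange x y n P eq = begin
      x * P                ≡⟨ solve (x ∷ P ∷ []) ⟩
      (+ 1 + x * P) - + 1  ≡⟨ cong (_- + 1) eq ⟩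
      y * n - + 1          ≡⟨ solve (y ∷ n ∷ []) ⟩
      n * y - + 1          ∎
      where open ≡-Reasoning

  1+yn≡xp⇒n[-y]≈1 : ∀ x y n → + 1 + y * n ≡ x * + p → n * - y ≈ + 1
  1+yn≡xp⇒n[-y]≈1 x y n eq = ∣⇒≈ (Signed.divides (- x) refl) (rearrange x y n (+ p) eq)
    where
    rearrange : ∀ x y n P → + 1 + y * n ≡ x * P → - x * P ≡ n * - y - + 1
    rearrange x y n P eq = begin
      - x * P              ≡⟨ solve (x ∷ P ∷ []) ⟩
      - (x * P)            ≡⟨ cong -_ (≡.sym eq) ⟩
      - (+ 1 + y * n)      ≡⟨ solve (y ∷ n ∷ []) ⟩
      n * - y - + 1        ∎
      where open ≡-Reasoning

  module _ (p-prime : Prime p) where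

    *≈0⇒≈0⊎≈0 : ∀ x y → x * y ≈ + 0 → x ≈ + 0 ⊎ y ≈ + 0
    *≈0⇒≈0⊎≈0 x y xy≈0 = Sum.map ∣⇒≈0 ∣⇒≈0
      (euclidsLemma ∣ x ∣ ∣ y ∣ p-prime (subst (p ℕ.∣_) (abs-* x y) (≈0⇒∣ xy≈0)))

    x*x≈0⇒x≈0 : ∀ x → x * x ≈ + 0 → x ≈ + 0
    x*x≈0⇒x≈0 x xx≈0 = reduce (*≈0⇒≈0⊎≈0 x x xx≈0)

    ∤⇒coprime : ∀ {n} → ¬ p ℕ.∣ n → Coprime p n
    ∤⇒coprime p∤n (d∣p , d∣n) with prime⇒irreducible p-prime d∣p
    ... | inj₁ d≡1 = d≡1
    ... | inj₂ refl = contradiction d∣n p∤n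

    ∤⇒invertible : ∀ n → ¬ p ℕ.∣ n → ∃ λ y → + n * y ≈ + 1
    ∤⇒invertible n p∤n with coprime-Bézout (∤⇒coprime p∤n)
    ... | Bézout.-+ x y eq = + y , 1+xp≡yn⇒ny≈1 (+ x) (+ y) (+ n) (pos-1+ab≡cd x p y n eq)
    ... | Bézout.+- x y eq = - + y , 1+yn≡xp⇒n[-y]≈1 (+ x) (+ y) (+ n) (pos-1+ab≡cd y n x p eq)

    ≉0⇒invertible : ∀ x → ¬ x ≈ + 0 → ∃ λ y → x * y ≈ + 1
    ≉0⇒invertible (+ n) x≉0 = ∤⇒invertible n (x≉0 ∘ ∣⇒≈0)
    ≉0⇒invertible x@(-[1+ n ]) x≉0 with ∤⇒invertible (ℕ.suc n) (x≉0 ∘ ∣⇒≈0 {x})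
    ... | y , ny≈1 = - y , (begin
      - + ℕ.suc n * - y   ≡⟨ solve (y ∷ []) ⟩
      + ℕ.suc n * y       ≈⟨ ny≈1 ⟩
      + 1                 ∎)
      where open ≈-Reasoning

    square-times-unit⇒square : ∀ X D s → X * X ≈ D * (s * s) → ¬ s ≈ + 0 → IsSquareMod p D
    square-times-unit⇒square X D s X²≈Ds² s≉0 with ≉0⇒invertible s s≉0
    ... | w , sw≈1 = square (X * w) (begin
      (X * w) * (X * w)          ≡⟨ solve (X ∷ w ∷ []) ⟩
      (X * X) * (w * w)          ≈⟨ *-congʳ (w * w) X²≈Ds² ⟩
      D * (s * s) * (w * w)      ≡⟨ solve (D ∷ s ∷ w ∷ []) ⟩
      D * ((s * w) * (s * w))    ≈⟨ *-congˡ D (*-cong sw≈1 sw≈1) ⟩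
      D * (+ 1 * + 1)            ≡⟨ solve (D ∷ []) ⟩
      D                          ∎)
      where open ≈-Reasoning

    degenerate⇒discriminant-square : ∀ A B C → A ≈ + 0 → IsSquareMod p (B * B - A * C)
    degenerate⇒discriminant-square A B C A≈0 = square B (begin
      B * B              ≡⟨ solve (B ∷ C ∷ []) ⟩
      B * B - + 0 * C    ≈⟨ +-congˡ (B * B) (-‿cong (*-congʳ C (≈-sym A≈0))) ⟩
      B * B - A * C      ∎)
      where open ≈-Reasoning

    isotropic⇒discriminant-square : ∀ A B C u s →
      quadForm A B C u s ≈ + 0 → ¬ s ≈ + 0 → IsSquareMod p (B * B - A * C)
    isotropic⇒discriminant-square A B C u s Q≈0 =
      square-times-unit⇒square (A * u + B * s) (B * B - A * C) s (begin
        (A * u + B * s) * (A * u + B * s)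
          ≡⟨ solve (A ∷ B ∷ C ∷ u ∷ s ∷ []) ⟩
        A * (A * (u * u) + + 2 * B * (u * s) + C * (s * s)) + (B * B - A * C) * (s * s)
          ≈⟨ +-congʳ ((B * B - A * C) * (s * s)) (*-congˡ A Q≈0) ⟩
        A * + 0 + (B * B - A * C) * (s * s)
          ≡⟨ solve (A ∷ B ∷ C ∷ s ∷ []) ⟩
        (B * B - A * C) * (s * s) ∎)
      where open ≈-Reasoning

    s≈0⇒quadForm≈Au² : ∀ A B C u s → s ≈ + 0 → quadForm A B C u s ≈ A * (u * u)
    s≈0⇒quadForm≈Au² A B C u s s≈0 = begin
      A * (u * u) + + 2 * B * (u * s) + C * (s * s)
        ≡⟨ solve (A ∷ B ∷ C ∷ u ∷ s ∷ []) ⟩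
      A * (u * u) + s * (+ 2 * B * u + C * s)
        ≈⟨ +-congˡ (A * (u * u)) (*-congʳ (+ 2 * B * u + C * s) s≈0) ⟩
      A * (u * u) + + 0 * (+ 2 * B * u + C * s)
        ≡⟨ solve (A ∷ B ∷ C ∷ u ∷ s ∷ []) ⟩
      A * (u * u) ∎
      where open ≈-Reasoning

    nonsquare-discriminant⇒anisotropic : ∀ A B C u s → χ≡-1 p (B * B - A * C) →
      quadForm A B C u s ≈ + 0 → u ≈ + 0 × s ≈ + 0
    nonsquare-discriminant⇒anisotropic A B C u s nonsquare Q≈0 = case ≈0? s of λ where
      (no s≉0)  → contradiction (isotropic⇒discriminant-square A B C u s Q≈0 s≉0) nonsquare
      (yes s≈0) →
        case *≈0⇒≈0⊎≈0 A (u * u) (≈-trans (≈-sym (s≈0⇒quadForm≈Au² A B C u s s≈0)) Q≈0) of λ where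
          (inj₁ A≈0)  → contradiction (degenerate⇒discriminant-square A B C A≈0) nonsquare
          (inj₂ u²≈0) → x*x≈0⇒x≈0 u u²≈0 , s≈0

    power-sums≈0⇒b≈a×c≈a : ∀ ℓᵢ ℓⱼ ℓₖ ℓₗ a b c d →
      χ≡-1 p ((ℓⱼ - ℓᵢ) * (ℓₖ - ℓⱼ) * (ℓₗ - ℓₖ) * (ℓᵢ - ℓₗ)) →
      (ℓⱼ - ℓᵢ) * a + (ℓₖ - ℓⱼ) * b + (ℓₗ - ℓₖ) * c + (ℓᵢ - ℓₗ) * d ≈ + 0 →
      (ℓⱼ - ℓᵢ) * (a * a) + (ℓₖ - ℓⱼ) * (b * b) + (ℓₗ - ℓₖ) * (c * c) + (ℓᵢ - ℓₗ) * (d * d)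
        ≈ + 0 →
      b ≈ a × c ≈ a
    power-sums≈0⇒b≈a×c≈a ℓᵢ ℓⱼ ℓₖ ℓₗ a b c d nonsquare sum₁ sum₂ =
      Product.map (x-y≈0⇒x≈y b a) (x-y≈0⇒x≈y c a)
        (nonsquare-discriminant⇒anisotropic
          (β * (β + δ)) (β * γ) (γ * (γ + δ)) (b - a) (c - a)
          (subst (χ≡-1 p) (cycle-product≡discriminant ℓᵢ ℓⱼ ℓₖ ℓₗ) nonsquare)
          (eliminate-last-variable β γ δ (b - a) (c - a) (d - a) linear quadratic))
      where
      open ≈-Reasoning

      β γ δ : ℤ
      β = ℓₖ - ℓⱼ
      γ = ℓₗ - ℓₖ
      δ = ℓᵢ - ℓₗ

      linear : β * (b - a) + γ * (c - a) + δ * (d - a) ≈ + 0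
      linear = begin
        β * (b - a) + γ * (c - a) + δ * (d - a)
          ≡⟨ recentre-linear ℓᵢ ℓⱼ ℓₖ ℓₗ a b c d ⟩
        (ℓⱼ - ℓᵢ) * a + β * b + γ * c + δ * d
          ≈⟨ sum₁ ⟩
        + 0 ∎

      quadratic : β * ((b - a) * (b - a)) + γ * ((c - a) * (c - a)) + δ * ((d - a) * (d - a))
                  ≈ + 0
      quadratic = begin
        β * ((b - a) * (b - a)) + γ * ((c - a) * (c - a)) + δ * ((d - a) * (d - a))
          ≡⟨ recentre-quadratic ℓᵢ ℓⱼ ℓₖ ℓₗ a b c d ⟩
        ((ℓⱼ - ℓᵢ) * (a * a) + β * (b * b) + γ * (c * c) + δ * (d * d))
          - + 2 * a * ((ℓⱼ - ℓᵢ) * a + β * b + γ * c + δ * d)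
          ≈⟨ +-cong sum₂ (-‿cong (*-congˡ (+ 2 * a) sum₁)) ⟩
        + 0 - + 2 * a * + 0
          ≡⟨ solve (a ∷ []) ⟩
        + 0 ∎

lemma5 : (p : ℕ) → Prime p → p ≢ 2 →
    (m : ℕ) (H : Graph m) (Λ : Fin m → ℤ) →
    (∀ i j → i ≢ j → ¬ (Λ i ≈[ p ] Λ j)) →
    (x y z w : Pt) (i j k l : Fin m) →
    Cycle4 p H Λ (x , i) (y , j) (z , k) (w , l) →
    χ≡-1 p (lamDiff Λ i j * lamDiff Λ j k * lamDiff Λ k l * lamDiff Λ l i) →
    ∃ λ (v : Pt) → ∃ λ (a : ℤ) → NonzeroMod p a
      × InHva p Λ v a (x , i) × InHva p Λ v a (y , j)
      × InHva p Λ v a (z , k) × InHva p Λ v a (w , l)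
lemma5 p p-prime _ _ _ Λ _ x y z w i j k l
  (((_ , a , a≉0 , x→y) , (_ , b , _ , y→z) , (_ , c , _ , z→w) , (_ , d , _ , w→x)) , _)
  nonsquare = v , a , a≉0 , x∈ , y∈ , z∈ , w∈
  where
  open Congruence p

  v : Pt
  v = shift x (- Λ i) a

  b≈a×c≈a : b ≈ a × c ≈ a
  b≈a×c≈a = uncurry (power-sums≈0⇒b≈a×c≈a p-prime (Λ i) (Λ j) (Λ k) (Λ l) a b c d nonsquare)
    (closed-walk⇒power-sums≈0 x y z w
      (lamDiff Λ i j) (lamDiff Λ j k) (lamDiff Λ k l) (lamDiff Λ l i) a b c d x→y y→z z→w w→x)

  x∈ : InHva p Λ v a (x , i)
  x∈ = shift-back x (Λ i) a

  y∈ : InHva p Λ v a (y , j)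
  y∈ = shift-along v x y (Λ i) (Λ j) x∈ x→y ≈-refl

  z∈ : InHva p Λ v a (z , k)
  z∈ = shift-along v y z (Λ j) (Λ k) y∈ y→z (proj₁ b≈a×c≈a)

  w∈ : InHva p Λ v a (w , l)
  w∈ = shift-along v z w (Λ k) (Λ l) z∈ z→w (proj₂ b≈a×c≈a)
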